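{- Suppose $\vec T$ satisfies Condition 1, 2 or 3 at every vertex of $H$ and satisfies Condition 2 at some vertex $b$ of $H$; let $\delta$ be the degree of $b$ in $H$. For each connected component $J$ of $K$ let $J'$ be the subgraph of $H$ consisting of all edges $a_{2i-1}a_{2i}$ for which $v_{2i-1}v_{2i}$ or $w_{2i-1}w_{2i}$ is an edge of $J$. Suppose there are $\kappa$ components $J_1,\dots,J_\kappa$ of $K$ such that each $J_\ell$ has at most one vertex at which Condition 2 holds, and $b$ has degree at least 2 in $J'_\ell$. Then at most $\delta-\kappa$ distinct vertices of $K$ lie over $b$.
   Context: $H$ is a connected finite simple graph with no leaves, vertices $1,\dots,t$, $k$ edges, oriented arbitrarily with directed edges $\overrightarrow{a_1a_2},\dots,\overrightarrow{a_{2k-1}a_{2k}}$; $\Gamma(b)=\{i:a_i=b\}$. $G$ is a finite simple graph and $\vec G$ its symmetric digraph. $\vec T=(\vec T_1,\vec T_2)$ is a $2k$-tuple of edges of $\vec G$ with $\vec T_1=(\overrightarrow{v_1v_2},\dots,\overrightarrow{v_{2k-1}v_{2k}})$, $\vec T_2=(\overrightarrow{w_1w_2},\dots,\overrightarrow{w_{2k-1}w_{2k}})$. $K$ is the undirected subgraph of $G$ consisting of the edges $v_{2i-1}v_{2i}$ and $w_{2i-1}w_{2i}$. The vertices of $K$ lying over a vertex $b$ of $H$ are the $v_i$ and $w_i$ with $i\in\Gamma(b)$. Conditions at a vertex $b$ of $H$: Condition 1: the $v_i$, $i\in\Gamma(b)$, are all equal and the $w_i$, $i\in\Gamma(b)$,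 are all equal. Condition 2: $v_i=w_i$ for all $i\in\Gamma(b)$. Condition 3: there are vertices $x,y$ of $G$ such that for every $i\in\Gamma(b)$, either ($v_i=x$, $w_i=y$) or ($v_i=y$, $w_i=x$). If $i\in\Gamma(b)$ and $\vec T$ satisfies a Condition at $b$, then $\vec T$ is said to satisfy that Condition at the vertices $v_i$ and $w_i$ of $K$. -}

module Defs where

open import Data.Nat using (ℕ; _≤_; _+_)
open import Data.Fin using (Fin; zero; suc)
open import Data.Fin.Properties using (_≟_)
open import Data.List using (List; length; filter; map; concatMap; deduplicate)
open import Data.List.Base using (allFin)
open import Data.Product using (Σ; ∃; ∃-syntax; _×_; _,_)
open import Data.Sum using (_⊎_)
open import Relation.Nullary using (¬_)
open import Relation.Nullary.Decidable using (_⊎-dec_; _×-dec_)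
open import Relation.Binary.PropositionalEquality using (_≡_; _≢_)
open import Data.List.Relation.Unary.Any using (any?)
open import Relation.Binary.Construct.Closure.ReflexiveTransitive using (Star)

-- An oriented graph with vertex set Fin t and k edges is given by
--   a : Fin k → Fin 2 → Fin t,
-- where edge i is directed a i tl → a i hd.  The index (i , tl) plays the
-- role of the paper's index 2i-1 and (i , hd) the role of 2i.
tl hd : Fin 2
tl = zero
hd = suc zero

Idx : ℕ → Set
Idx k = Fin k × Fin 2

InΓ : ∀ {t k} → (Fin k → Fin 2 → Fin t) → Fin t → Idx k → Set
InΓ a b (i , e) = a i e ≡ b

Incident : ∀ {t k} → (Fin k → Fin 2 → Fin t) → Fin t → Fin k → Set
Incident a p i = (a i tl ≡ p) ⊎ (a i hd ≡ p)

degree : ∀ {t k} → (Fin k → Fin 2 → Fin t) → Fin t → ℕ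
degree {k = k} a p =
  length (filter (λ i → (a i tl ≟ p) ⊎-dec (a i hd ≟ p)) (allFin k))

AdjH : ∀ {t k} → (Fin k → Fin 2 → Fin t) → Fin t → Fin t → Set
AdjH a p q = ∃[ i ] ((a i tl ≡ p × a i hd ≡ q) ⊎ (a i tl ≡ q × a i hd ≡ p))

IsSimple : ∀ {t k} → (Fin k → Fin 2 → Fin t) → Set
IsSimple {k = k} a =
  (∀ i → a i tl ≢ a i hd) ×
  (∀ i i' → i ≢ i' →
     ¬ (a i tl ≡ a i' tl × a i hd ≡ a i' hd) ×
     ¬ (a i tl ≡ a i' hd × a i hd ≡ a i' tl))

IsConnected : ∀ {t k} → (Fin k → Fin 2 → Fin t) → Set
IsConnected a = ∀ p q → Star (AdjH a) p q

NoLeaves : ∀ {t k} → (Fin k → Fin 2 → Fin t) → Set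
NoLeaves a = ∀ p → degree a p ≢ 1

IsSimpleGraph : ∀ {n} → (Fin n → Fin n → Set) → Set
IsSimpleGraph E = (∀ x y → E x y → E y x) × (∀ x → ¬ E x x)

-- The 2k-tuple T⃗ = (T⃗₁ , T⃗₂) consists of v w : Idx k → Fin n with
-- (v (i,tl) , v (i,hd)) and (w (i,tl) , w (i,hd)) directed edges of G⃗.
IsTuple : ∀ {n k} → (Fin n → Fin n → Set) → (Idx k → Fin n) → (Idx k → Fin n) → Set
IsTuple E v w = ∀ i → E (v (i , tl)) (v (i , hd)) × E (w (i , tl)) (w (i , hd))

Cond1 Cond2 Cond3 : ∀ {t k n} → (Fin k → Fin 2 → Fin t) →
  (Idx k → Fin n) → (Idx k → Fin n) → Fin t → Set
Cond1 a v w b = ∀ j j' → InΓ a b j → InΓ a b j' → v j ≡ v j' × w j ≡ w j'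
Cond2 a v w b = ∀ j → InΓ a b j → v j ≡ w j
Cond3 {n = n} a v w b = ∃[ x ] ∃[ y ] (∀ j → InΓ a b j →
  (v j ≡ x × w j ≡ y) ⊎ (v j ≡ y × w j ≡ x))

EdgeK : ∀ {n k} → (Idx k → Fin n) → (Idx k → Fin n) → Fin n → Fin n → Set
EdgeK v w x y = ∃[ i ]
  ((v (i , tl) ≡ x × v (i , hd) ≡ y) ⊎ (v (i , tl) ≡ y × v (i , hd) ≡ x) ⊎
   (w (i , tl) ≡ x × w (i , hd) ≡ y) ⊎ (w (i , tl) ≡ y × w (i , hd) ≡ x))

VertexK : ∀ {n k} → (Idx k → Fin n) → (Idx k → Fin n) → Fin n → Set
VertexK v w x = ∃[ j ] (v j ≡ x ⊎ w j ≡ x)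

-- Connectedness inside K; the component of a vertex x of K is
-- { y | ReachK v w x y }.
ReachK : ∀ {n k} → (Idx k → Fin n) → (Idx k → Fin n) → Fin n → Fin n → Set
ReachK v w = Star (EdgeK v w)

Cond2At : ∀ {t k n} → (Fin k → Fin 2 → Fin t) →
  (Idx k → Fin n) → (Idx k → Fin n) → Fin n → Set
Cond2At a v w y = ∃[ b' ] ∃[ j ] (InΓ a b' j × Cond2 a v w b' × (v j ≡ y ⊎ w j ≡ y))

-- Edge i of H belongs to J' where J is the component of K containing x:
-- v_{2i-1}v_{2i} or w_{2i-1}w_{2i} is an edge of J.
InJ' : ∀ {t k n} → (Fin k → Fin 2 → Fin t) →
  (Idx k → Fin n) → (Idx k → Fin n) → Fin n → Fin k → Set
InJ' a v w x i = ReachK v w x (v (i , tl)) ⊎ ReachK v w x (w (i , tl))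

DegJ'≥2 : ∀ {t k n} → (Fin k → Fin 2 → Fin t) →
  (Idx k → Fin n) → (Idx k → Fin n) → Fin n → Fin t → Set
DegJ'≥2 a v w x b = ∃[ i ] ∃[ i' ] (i ≢ i' ×
  Incident a b i × InJ' a v w x i × Incident a b i' × InJ' a v w x i')

allIdx : ∀ k → List (Idx k)
allIdx k = concatMap (λ i → map (λ e → (i , e)) (allFin 2)) (allFin k)

numOver : ∀ {t k n} → (Fin k → Fin 2 → Fin t) →
  (Idx k → Fin n) → (Idx k → Fin n) → Fin t → ℕ
numOver {k = k} {n = n} a v w b =
  length (filter (λ x → any?
                          (λ j → (InΓ? j) ×-dec ((v j ≟ x) ⊎-dec (w j ≟ x)))
                          (allIdx k))
                 (allFin n))
  where
  InΓ? : ∀ j → _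
  InΓ? (i , e) = a i e ≟ b

-- Every vertex of K over b is some v_j = w_j with j ∈ Γ(b) (Condition 2 at b), so
-- their number is the size of the image of j ↦ v_j on Γ(b), a set of δ indices
-- (H has no loops).  In a component J_ℓ, the two edges of J'_ℓ at b give two
-- indices of Γ(b) whose v-values are vertices of J_ℓ satisfying Condition 2, hence
-- equal.  The values produced by different components lie in different components,
-- so they are distinct, and each distinct value with two preimages lowers the image
-- size below δ by one.
module Submission where

open import Defs
open import Data.Nat using (ℕ; suc; _≤_; _+_; z≤n; s≤s)
open import Data.Nat.Properties
  using (≤-refl; ≤-trans; ≤-reflexive; n≤1+n; +-suc; +-identityʳ; +-mono-≤; +-monoˡ-≤; +-monoʳ-≤; module ≤-Reasoning)
open import Data.Fin using (Fin)
open import Data.Fin.Properties using (_≟_)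
open import Data.List using (List; []; _∷_; [_]; _++_; length; filter; map; concatMap; tabulate; allFin)
open import Data.List.Properties using (filter-accept; filter-none; filter-≐; filter-++; length-++; length-++-sucʳ; length-tabulate)
open import Data.List.Relation.Unary.Any using (Any; here; there; any?)
open import Data.List.Relation.Unary.All as All using (All)
open import Data.List.Relation.Unary.All.Properties as All using ()
open import Data.List.Relation.Unary.AllPairs using ([]; _∷_)
open import Data.List.Relation.Unary.Unique.Propositional using (Unique)
open import Data.List.Relation.Unary.Unique.Propositional.Properties using (allFin⁺; tabulate⁺)
open import Data.List.Membership.Propositional using (_∈_; find; lose)
open import Data.List.Membership.Propositional.Properties using (∈-allFin; ∈-map⁺; ∈-concatMap⁺; ∈-filter⁺; ∈-filter⁻; ∈-∃++)
open import Data.List.Relation.Binary.Subset.Propositional.Properties using (Any-resp-⊆)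
open import Data.List.Relation.Binary.Permutation.Propositional using (↭-sym)
open import Data.List.Relation.Binary.Permutation.Propositional.Properties using (∈-resp-↭; shift)
open import Data.Product using (_×_; ∃-syntax; ∃₂; _,_; proj₁; proj₂)
open import Data.Sum using (_⊎_; inj₁; inj₂)
open import Function using (_∘_)
open import Relation.Nullary using (¬_; yes; no; contradiction)
open import Relation.Nullary.Decidable using (_⊎-dec_; decidable-stable)
open import Relation.Unary using (Pred; Decidable; _⊆_; _∪_; _≐_)
open import Relation.Binary.Definitions using (DecidableEquality)
open import Relation.Binary.PropositionalEquality using (_≡_; _≢_; refl; sym; trans; cong; cong₂; subst; module ≡-Reasoning)
open import Relation.Binary.Construct.Closure.ReflexiveTransitive using (ε; _◅_; _◅◅_; reverse)

length-filter-∷ : ∀ {a p} {A : Set a} {P : Pred A p} (P? : Decidable P) x xs →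
  length (filter P? xs) ≤ length (filter P? (x ∷ xs))
length-filter-∷ P? x xs with P? x
... | yes _ = n≤1+n _
... | no _  = ≤-refl

module _ {a p q r} {A : Set a} {P : Pred A p} {Q : Pred A q} {R : Pred A r}
         (P? : Decidable P) (Q? : Decidable Q) (R? : Decidable R) where

  length-filter-⊆-∪ : P ⊆ Q ∪ R → ∀ xs →
    length (filter P? xs) ≤ length (filter Q? xs) + length (filter R? xs)
  length-filter-⊆-∪ P⊆Q∪R [] = z≤n
  length-filter-⊆-∪ P⊆Q∪R (x ∷ xs) with ih ← length-filter-⊆-∪ P⊆Q∪R xs | P? x
  ... | no _ = ≤-trans ih (+-mono-≤ (length-filter-∷ Q? x xs) (length-filter-∷ R? x xs))
  ... | yes px with P⊆Q∪R px
  ...   | inj₁ qx rewrite filter-accept Q? {xs = xs} qx =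
    s≤s (≤-trans ih (+-monoʳ-≤ _ (length-filter-∷ R? x xs)))
  ...   | inj₂ rx rewrite filter-accept R? {xs = xs} rx | +-suc (length (filter Q? (x ∷ xs))) (length (filter R? xs)) =
    s≤s (≤-trans ih (+-monoˡ-≤ _ (length-filter-∷ Q? x xs)))

length-filter-≟-≤1 : ∀ {a} {A : Set a} (_≟_ : DecidableEquality A) y {xs : List A} →
  Unique xs → length (filter (y ≟_) xs) ≤ 1
length-filter-≟-≤1 _≟_ y [] = z≤n
length-filter-≟-≤1 _≟_ y {x ∷ xs} (x∉xs ∷ xs!) with y ≟ x
... | yes refl = s≤s (≤-reflexive (cong length (filter-none (y ≟_) x∉xs)))
... | no _     = length-filter-≟-≤1 _≟_ y xs!

module _ {a} {A : Set a} {j : A} where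

  ∈-shift⁻ : ∀ ys zs {k} → k ∈ ys ++ j ∷ zs → k ≡ j ⊎ k ∈ ys ++ zs
  ∈-shift⁻ ys zs k∈ with ∈-resp-↭ (shift j ys zs) k∈
  ... | here k≡j  = inj₁ k≡j
  ... | there k∈′ = inj₂ k∈′

  ∈-shift⁺ : ∀ ys zs {k} → k ∈ ys ++ zs → k ∈ ys ++ j ∷ zs
  ∈-shift⁺ ys zs = ∈-resp-↭ (↭-sym (shift j ys zs)) ∘ there

module ImageSize {a} {A : Set a} {n : ℕ} (h : A → Fin n) where

  Image : List A → Pred (Fin n) a
  Image L x = Any (λ j → h j ≡ x) L

  image? : ∀ L → Decidable (Image L)
  image? L x = any? (λ j → h j ≟ x) L

  imageSize : List A → ℕ
  imageSize L = length (filter (image? L) (allFin n))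

  imageSize-cong : ∀ {L L′} → Image L ≐ Image L′ → imageSize L ≡ imageSize L′
  imageSize-cong L≐L′ = cong length (filter-≐ (image? _) (image? _) L≐L′ (allFin n))

  imageSize-∷ : ∀ j L → imageSize (j ∷ L) ≤ suc (imageSize L)
  imageSize-∷ j L =
    ≤-trans (length-filter-⊆-∪ (image? (j ∷ L)) (h j ≟_) (image? L) split (allFin n))
            (+-monoˡ-≤ (imageSize L) (length-filter-≟-≤1 _≟_ (h j) (allFin⁺ n)))
    where
    split : Image (j ∷ L) ⊆ (h j ≡_) ∪ Image L
    split (here hj≡x)  = inj₁ hj≡x
    split (there x∈hL) = inj₂ x∈hL

  imageSize≤length : ∀ L → imageSize L ≤ length L
  imageSize≤length [] =
    ≤-reflexive (cong length (filter-none (image? []) (All.universal (λ _ ()) (allFin n))))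
  imageSize≤length (j ∷ L) = ≤-trans (imageSize-∷ j L) (s≤s (imageSize≤length L))

  Collision : List A → Pred (Fin n) a
  Collision L u = ∃₂ λ j j′ → j ≢ j′ × j ∈ L × j′ ∈ L × h j ≡ u × h j′ ≡ u

  -- Deleting one of the two preimages of a collision value keeps the image and
  -- every other collision, and shortens the list by one.
  imageSize+collisions≤length : ∀ L {U} → Unique U → All (Collision L) U →
    imageSize L + length U ≤ length L
  imageSize+collisions≤length L [] All.[] =
    ≤-trans (≤-reflexive (+-identityʳ _)) (imageSize≤length L)
  imageSize+collisions≤length L {u ∷ U} (u∉U ∷ U!)
    ((j , j′ , j≢j′ , j∈L , j′∈L , hj≡u , hj′≡u) All.∷ collisions)
    with ys , zs , refl ← ∈-∃++ j∈L = begin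
      imageSize (ys ++ j ∷ zs) + suc (length U) ≡⟨ cong₂ _+_ (imageSize-cong (drop-j , keep)) refl ⟩
      imageSize L′ + suc (length U)             ≡⟨ +-suc (imageSize L′) (length U) ⟩
      suc (imageSize L′ + length U)             ≤⟨ s≤s (imageSize+collisions≤length L′ U! collisions′) ⟩
      suc (length L′)                           ≡⟨ sym (length-++-sucʳ ys j zs) ⟩
      length (ys ++ j ∷ zs)                     ∎
    where
    open ≤-Reasoning
    L′ = ys ++ zs

    j′∈L′ : j′ ∈ L′
    j′∈L′ with ∈-shift⁻ ys zs j′∈L
    ... | inj₁ refl  = contradiction refl j≢j′
    ... | inj₂ j′∈L′ = j′∈L′

    drop-j : Image (ys ++ j ∷ zs) ⊆ Image L′
    drop-j x∈hL with k , k∈L , hk≡x ← find x∈hL with ∈-shift⁻ ys zs k∈L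
    ... | inj₁ refl = lose j′∈L′ (trans hj′≡u (trans (sym hj≡u) hk≡x))
    ... | inj₂ k∈L′ = lose k∈L′ hk≡x

    keep : Image L′ ⊆ Image (ys ++ j ∷ zs)
    keep = Any-resp-⊆ (∈-shift⁺ ys zs)

    survives : ∀ {u′} → u ≢ u′ → Collision (ys ++ j ∷ zs) u′ → Collision L′ u′
    survives {u′} u≢u′ (k , k′ , k≢k′ , k∈L , k′∈L , hk≡u′ , hk′≡u′) =
      k , k′ , k≢k′ , avoid-j k∈L hk≡u′ , avoid-j k′∈L hk′≡u′ , hk≡u′ , hk′≡u′
      where
      avoid-j : ∀ {m} → m ∈ ys ++ j ∷ zs → h m ≡ u′ → m ∈ L′
      avoid-j m∈L hm≡u′ with ∈-shift⁻ ys zs m∈L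
      ... | inj₁ refl = contradiction (trans (sym hj≡u) hm≡u′) u≢u′
      ... | inj₂ m∈L′ = m∈L′

    collisions′ : All (Collision L′) U
    collisions′ = All.zipWith (λ (u≢u′ , c) → survives u≢u′ c) (u∉U , collisions)

open ImageSize using (Image; image?; imageSize; Collision; imageSize+collisions≤length)

∈-allIdx : ∀ {k} (j : Idx k) → j ∈ allIdx k
∈-allIdx (i , e) = ∈-concatMap⁺ _ (lose (∈-allFin i) (∈-map⁺ (i ,_) (∈-allFin e)))

module _ {t k} (a : Fin k → Fin 2 → Fin t) (b : Fin t) where

  inΓ? : Decidable (InΓ a b)
  inΓ? (i , e) = a i e ≟ b

  incident? : Decidable (Incident a b)
  incident? i = (a i tl ≟ b) ⊎-dec (a i hd ≟ b)

  Γ : List (Idx k)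
  Γ = filter inΓ? (allIdx k)

  ∈-Γ : ∀ {j} → InΓ a b j → j ∈ Γ
  ∈-Γ {j} = ∈-filter⁺ inΓ? (∈-allIdx j)

  length-Γ≡degree : (∀ i → a i tl ≢ a i hd) → length Γ ≡ degree a b
  length-Γ≡degree loopless = go (allFin k)
    where
    ends : Fin k → List (Idx k)
    ends i = map (i ,_) (allFin 2)

    one-end-at-b : ∀ i → length (filter inΓ? (ends i)) ≡ length (filter incident? [ i ])
    one-end-at-b i with a i tl ≟ b
    ... | yes tl≡b with a i hd ≟ b
    ...   | yes hd≡b = contradiction (trans tl≡b (sym hd≡b)) (loopless i)
    ...   | no _     = refl
    one-end-at-b i | no _ with a i hd ≟ b
    ...   | yes _ = refl
    ...   | no _  = refl

    go : ∀ is → length (filter inΓ? (concatMap ends is)) ≡ length (filter incident? is)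
    go [] = refl
    go (i ∷ is) = begin
      length (filter inΓ? (ends i ++ concatMap ends is))
        ≡⟨ cong length (filter-++ inΓ? (ends i) _) ⟩
      length (filter inΓ? (ends i) ++ filter inΓ? (concatMap ends is))
        ≡⟨ length-++ (filter inΓ? (ends i)) ⟩
      length (filter inΓ? (ends i)) + length (filter inΓ? (concatMap ends is))
        ≡⟨ cong₂ _+_ (one-end-at-b i) (go is) ⟩
      length (filter incident? [ i ]) + length (filter incident? is)
        ≡⟨ sym (length-++ (filter incident? [ i ])) ⟩
      length (filter incident? [ i ] ++ filter incident? is)
        ≡⟨ cong length (sym (filter-++ incident? [ i ] is)) ⟩
      length (filter incident? (i ∷ is)) ∎
      where open ≡-Reasoning

EdgeK-sym : ∀ {n k} {v w : Idx k → Fin n} {x y} → EdgeK v w x y → EdgeK v w y x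
EdgeK-sym (i , inj₁ e)               = i , inj₂ (inj₁ e)
EdgeK-sym (i , inj₂ (inj₁ e))        = i , inj₁ e
EdgeK-sym (i , inj₂ (inj₂ (inj₁ e))) = i , inj₂ (inj₂ (inj₂ e))
EdgeK-sym (i , inj₂ (inj₂ (inj₂ e))) = i , inj₂ (inj₂ (inj₁ e))

ReachK-sym : ∀ {n k} {v w : Idx k → Fin n} {x y} → ReachK v w x y → ReachK v w y x
ReachK-sym {v = v} {w} = reverse (EdgeK-sym {v = v} {w})

module _ {t k n} (a : Fin k → Fin 2 → Fin t) {v w : Idx k → Fin n} {b : Fin t}
         (cond2 : Cond2 a v w b) where

  numOver≡imageSize : numOver a v w b ≡ imageSize v (Γ a b)
  numOver≡imageSize = cong length (filter-≐ _ (image? v (Γ a b)) (to , from) (allFin n))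
    where
    to : ∀ {x} → Any (λ j → InΓ a b j × (v j ≡ x ⊎ w j ≡ x)) (allIdx k) → Image v (Γ a b) x
    to p with find p
    ... | j , _ , j∈Γb , inj₁ vj≡x = lose (∈-Γ a b j∈Γb) vj≡x
    ... | j , _ , j∈Γb , inj₂ wj≡x = lose (∈-Γ a b j∈Γb) (trans (cond2 j j∈Γb) wj≡x)

    from : ∀ {x} → Image v (Γ a b) x → Any (λ j → InΓ a b j × (v j ≡ x ⊎ w j ≡ x)) (allIdx k)
    from p with j , j∈Γ , vj≡x ← find p
      = lose (∈-allIdx j) (proj₂ (∈-filter⁻ (inΓ? a b) {xs = allIdx k} j∈Γ) , inj₁ vj≡x)

  -- The end of edge i over b lies in J: the other end is joined to it by the
  -- K-edge v_{2i-1}v_{2i} (or w_{2i-1}w_{2i}), and v = w over b.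
  J′-edge-end-over-b : ∀ {x i} → Incident a b i → InJ' a v w x i →
    ∃[ e ] (InΓ a b (i , e) × ReachK v w x (v (i , e)))
  J′-edge-end-over-b (inj₁ tl≡b) (inj₁ x↝v) = tl , tl≡b , x↝v
  J′-edge-end-over-b {x} (inj₁ tl≡b) (inj₂ x↝w) =
    tl , tl≡b , subst (ReachK v w x) (sym (cond2 _ tl≡b)) x↝w
  J′-edge-end-over-b {i = i} (inj₂ hd≡b) (inj₁ x↝v) =
    hd , hd≡b , x↝v ◅◅ (i , inj₁ (refl , refl)) ◅ ε
  J′-edge-end-over-b {x} {i} (inj₂ hd≡b) (inj₂ x↝w) =
    hd , hd≡b , subst (ReachK v w x) (sym (cond2 _ hd≡b))
                      (x↝w ◅◅ (i , inj₂ (inj₂ (inj₁ (refl , refl)))) ◅ ε)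

  component-collision : ∀ {x} →
    (∀ y z → ReachK v w x y → ReachK v w x z → Cond2At a v w y → Cond2At a v w z → y ≡ z) →
    DegJ'≥2 a v w x b →
    ∃[ u ] (ReachK v w x u × Collision v (Γ a b) u)
  component-collision one-cond2 (i , i′ , i≢i′ , i∋b , i∈J′ , i′∋b , i′∈J′)
    with e , ie∈Γb , x↝u ← J′-edge-end-over-b i∋b i∈J′
       | e′ , ie′∈Γb , x↝u′ ← J′-edge-end-over-b i′∋b i′∈J′ =
    v (i , e) , x↝u , (i , e) , (i′ , e′) , i≢i′ ∘ cong proj₁ ,
    ∈-Γ a b ie∈Γb , ∈-Γ a b ie′∈Γb , refl ,
    sym (one-cond2 _ _ x↝u x↝u′ (b , _ , ie∈Γb , cond2 , inj₁ refl) (b , _ , ie′∈Γb , cond2 , inj₁ refl))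

lemma3p8 : ∀ {t k n} (a : Fin k → Fin 2 → Fin t) →
    IsSimple a → IsConnected a → NoLeaves a →
    (E : Fin n → Fin n → Set) → IsSimpleGraph E →
    (v w : Idx k → Fin n) → IsTuple E v w →
    (∀ b' → Cond1 a v w b' ⊎ Cond2 a v w b' ⊎ Cond3 a v w b') →
    (b : Fin t) → Cond2 a v w b →
    (κ : ℕ) (x : Fin κ → Fin n) →
    (∀ ℓ → VertexK v w (x ℓ)) →
    (∀ ℓ ℓ' → ℓ ≢ ℓ' → ¬ ReachK v w (x ℓ) (x ℓ')) →
    (∀ ℓ y z → ReachK v w (x ℓ) y → ReachK v w (x ℓ) z →
       Cond2At a v w y → Cond2At a v w z → y ≡ z) →
    (∀ ℓ → DegJ'≥2 a v w (x ℓ) b) →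
    numOver a v w b + κ ≤ degree a b
lemma3p8 {n = n} a (loopless , _) _ _ _ _ v w _ _ b cond2 κ x _ separated one-cond2 deg≥2 = begin
  numOver a v w b + κ                        ≡⟨ cong₂ _+_ (numOver≡imageSize a cond2) (sym (length-tabulate u)) ⟩
  imageSize v (Γ a b) + length (tabulate u)  ≤⟨ imageSize+collisions≤length v (Γ a b) (tabulate⁺ u-injective)
                                                  (All.tabulate⁺ (proj₂ ∘ proj₂ ∘ collision)) ⟩
  length (Γ a b)                             ≡⟨ length-Γ≡degree a b loopless ⟩
  degree a b                                 ∎
  where
  open ≤-Reasoning

  collision : ∀ ℓ → ∃[ u ] (ReachK v w (x ℓ) u × Collision v (Γ a b) u)
  collision ℓ = component-collision a cond2 (one-cond2 ℓ) (deg≥2 ℓ)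

  u : Fin κ → Fin n
  u = proj₁ ∘ collision

  u-injective : ∀ {ℓ ℓ′} → u ℓ ≡ u ℓ′ → ℓ ≡ ℓ′
  u-injective {ℓ} {ℓ′} uℓ≡uℓ′ = decidable-stable (ℓ ≟ ℓ′) λ ℓ≢ℓ′ → separated ℓ ℓ′ ℓ≢ℓ′
    (proj₁ (proj₂ (collision ℓ)) ◅◅
     ReachK-sym {v = v} {w} (subst (ReachK v w (x ℓ′)) (sym uℓ≡uℓ′) (proj₁ (proj₂ (collision ℓ′)))))
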